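{- Let $n\geq 5$ be an integer such that $4\nmid n$. Then the parameter set $t$-$(v,k,\lambda)$ with $t=4$, $v=\binom{n}{2}+2$, $k=n+1$, $\lambda=2$ is admissible, but there is no block design with these parameters.
   Context: A $t$-$(v,k,\lambda)$ (block) design is a set $D$ of $k$-element subsets (blocks) of a $v$-element set $V$ such that every $t$-element subset of $V$ is contained in exactly $\lambda$ blocks (blocks are not repeated). The parameter set $t$-$(v,k,\lambda)$ is admissible if $\lambda_i=\frac{\binom{v-i}{t-i}}{\binom{k-i}{t-i}}\lambda$ is an integer for all $i\in\{0,\ldots,t\}$. -}

module Defs where

open import Data.Nat using (ℕ; _∸_; _*_; _≤_)
open import Data.Nat.Divisibility using (_∣_)
open import Data.Nat.Combinatorics using (_C_)
open import Data.Fin.Subset using (Subset; ∣_∣)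
open import Data.Fin.Subset.Properties using (_⊆?_)
open import Data.List using (List; length; filter)
open import Data.List.Relation.Unary.All using (All)
open import Data.List.Relation.Unary.Unique.Propositional using (Unique)
open import Data.Product using (_×_)
open import Relation.Binary.PropositionalEquality using (_≡_)

Admissible : ℕ → ℕ → ℕ → ℕ → Set
Admissible t v k lam =
  ∀ (i : ℕ) → i ≤ t → ((k ∸ i) C (t ∸ i)) ∣ (((v ∸ i) C (t ∸ i)) * lam)

countContaining : ∀ {v} → Subset v → List (Subset v) → ℕ
countContaining T D = length (filter (T ⊆?_) D)

IsDesign : (t v k lam : ℕ) → List (Subset v) → Set
IsDesign t v k lam D =
  Unique D ×
  All (λ B → ∣ B ∣ ≡ k) D ×
  (∀ (T : Subset v) → ∣ T ∣ ≡ t → countContaining T D ≡ lam)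

-- With m = C(n,2), the numbers λᵢ = 2·C(v−i,4−i)/C(k−i,4−i) work out to C(m+2,2), (m+1)(n+1)/2,
-- C(n+1,2), n+1 and 2; only λ₁ needs 4 ∤ n, which makes (m+1)(n+1) even.
--
-- In a design every i-set (i ≤ 4) lies in exactly λᵢ blocks, so for a block B the binomial moments
-- Σ_{B′} C(|B ∩ B′|, s), s ≤ 4, equal λₛ·C(k,s). Expanding f(J)² in the basis C(J,s), where
-- f(J) = (Y−2)J² − (5Y−2)J + 4n(n+1) and Y = n(n−1), these moments give Σ_{B′} f(|B ∩ B′|)² = f(k)²,
-- the contribution of B′ = B alone. But the two blocks through a 4-set meet in at least 4 points,
-- and f is positive on integers ≥ 4 when n ≥ 5.

module Submission where

open import Algebra.Bundles using (CommutativeSemiring)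
open import Data.List using (List; []; _∷_; _++_; map; filter; length; upTo)
open import Data.List.Relation.Unary.All as All using (All; []; _∷_)
open import Function using (_∘_)

module ListSum {c ℓ} (R : CommutativeSemiring c ℓ) where
  open CommutativeSemiring R
  open import Algebra.Properties.CommutativeSemigroup +-commutativeSemigroup using (interchange)
  open import Relation.Binary.Reasoning.Setoid setoid

  ∑ : {A : Set} → List A → (A → Carrier) → Carrier
  ∑ []       f = 0#
  ∑ (x ∷ xs) f = f x + ∑ xs f

  module _ {A : Set} where

    ∑-cong : ∀ (xs : List A) {f g : A → Carrier} → (∀ x → f x ≈ g x) → ∑ xs f ≈ ∑ xs g
    ∑-cong []       f≈g = refl
    ∑-cong (x ∷ xs) f≈g = +-cong (f≈g x) (∑-cong xs f≈g)

    ∑-congᴬ : ∀ {P : A → Set} (xs : List A) {f g : A → Carrier} →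
              All P xs → (∀ x → P x → f x ≈ g x) → ∑ xs f ≈ ∑ xs g
    ∑-congᴬ []       []         f≈g = refl
    ∑-congᴬ (x ∷ xs) (px ∷ pxs) f≈g = +-cong (f≈g x px) (∑-congᴬ xs pxs f≈g)

    ∑-++ : ∀ (xs ys : List A) (f : A → Carrier) → ∑ (xs ++ ys) f ≈ ∑ xs f + ∑ ys f
    ∑-++ []       ys f = sym (+-identityˡ _)
    ∑-++ (x ∷ xs) ys f = trans (+-congˡ (∑-++ xs ys f)) (sym (+-assoc _ _ _))

    ∑-zero : ∀ (xs : List A) → ∑ xs (λ _ → 0#) ≈ 0#
    ∑-zero []       = refl
    ∑-zero (x ∷ xs) = trans (+-identityˡ _) (∑-zero xs)

    ∑-+ : ∀ (xs : List A) (f g : A → Carrier) → ∑ xs (λ x → f x + g x) ≈ ∑ xs f + ∑ xs g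
    ∑-+ []       f g = sym (+-identityˡ 0#)
    ∑-+ (x ∷ xs) f g = trans (+-congˡ (∑-+ xs f g)) (interchange _ _ _ _)

    ∑-*ˡ : ∀ (xs : List A) a (f : A → Carrier) → ∑ xs (λ x → a * f x) ≈ a * ∑ xs f
    ∑-*ˡ []       a f = sym (zeroʳ a)
    ∑-*ˡ (x ∷ xs) a f = trans (+-congˡ (∑-*ˡ xs a f)) (sym (distribˡ a _ _))

    ∑-*ʳ : ∀ (xs : List A) (f : A → Carrier) a → ∑ xs (λ x → f x * a) ≈ ∑ xs f * a
    ∑-*ʳ xs f a = trans (∑-cong xs (λ x → *-comm (f x) a)) (trans (∑-*ˡ xs a f) (*-comm a _))

  ∑-map : ∀ {A B : Set} (h : A → B) (xs : List A) (f : B → Carrier) → ∑ (map h xs) f ≈ ∑ xs (f ∘ h)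
  ∑-map h []       f = refl
  ∑-map h (x ∷ xs) f = +-congˡ (∑-map h xs f)

  ∑-swap : ∀ {A B : Set} (xs : List A) (ys : List B) (f : A → B → Carrier) →
           ∑ xs (λ x → ∑ ys (f x)) ≈ ∑ ys (λ y → ∑ xs (λ x → f x y))
  ∑-swap []       ys f = sym (∑-zero ys)
  ∑-swap (x ∷ xs) ys f = begin
    ∑ ys (f x) + ∑ xs (λ x → ∑ ys (f x))           ≈⟨ +-congˡ (∑-swap xs ys f) ⟩
    ∑ ys (f x) + ∑ ys (λ y → ∑ xs (λ x → f x y))   ≈⟨ ∑-+ ys (f x) _ ⟨
    ∑ ys (λ y → f x y + ∑ xs (λ x → f x y))        ∎

  ∑-double : ∀ {A B : Set} (xs : List A) (ys : List B) (g : A → Carrier) (h : A → B → Carrier) →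
             ∑ ys (λ y → ∑ xs (λ x → g x * h x y)) ≈ ∑ xs (λ x → g x * ∑ ys (h x))
  ∑-double xs ys g h = trans (∑-swap ys xs _) (∑-cong xs (λ x → ∑-*ˡ ys (g x) (h x)))

open import Defs
open import Data.Fin.Subset using (Subset; ∣_∣; _∩_; _⊆_)
open import Data.Fin.Subset.Properties using (_⊆?_; ∩-idem; p⊆q⇒∣p∣≤∣q∣; x∈p∩q⁺)
open import Data.Nat as ℕ using (ℕ; zero; suc; _≤_; _!; z≤n; s≤s)
import Data.Nat.Properties as ℕ
open import Data.Nat.Combinatorics using (_C_; nCk+nC[k+1]≡[n+1]C[k+1])
open import Data.Product as Product using (Σ; ∃; _×_; _,_; proj₁; proj₂)
open import Relation.Nullary using (¬_; does; contradiction)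
open import Relation.Unary using (Decidable)
open import Relation.Binary.PropositionalEquality

open ListSum ℕ.+-*-commutativeSemiring

module SubsetCounting where
  open import Data.Bool using (Bool; true; false; _∧_; T)
  open import Data.Bool.Properties using (∧-assoc; ∧-zeroʳ)
  open import Data.Fin.Subset using (_─_; ⊤; inside; outside) renaming (⊥ to ∅)
  open import Data.Fin.Subset.Properties using (∩-identityˡ; ∣⊥∣≡0; ∣⊤∣≡n; ⊆-trans; ⊆⊤; ⊥⊆)
  open import Relation.Nullary using (yes; no)
  open import Data.Nat using (_+_; _*_; _∸_; _≡ᵇ_)
  open import Data.Vec using ([]; _∷_)

  _⊆ᵇ_ : ∀ {v} → Subset v → Subset v → Bool
  p ⊆ᵇ q = does (p ⊆? q)

  𝟙 : Bool → ℕ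
  𝟙 true  = 1
  𝟙 false = 0

  𝟙-∧ : ∀ a b → 𝟙 (a ∧ b) ≡ 𝟙 a * 𝟙 b
  𝟙-∧ true  b = sym (ℕ.+-identityʳ (𝟙 b))
  𝟙-∧ false b = refl

  ⊆ᵇ⇒⊆ : ∀ {v} (L S : Subset v) → T (L ⊆ᵇ S) → L ⊆ S
  ⊆ᵇ⇒⊆ L S L⊆S with L ⊆? S
  ... | yes L⊆S = L⊆S

  ⊆⇒⊆ᵇ : ∀ {v} (L S : Subset v) → L ⊆ S → T (L ⊆ᵇ S)
  ⊆⇒⊆ᵇ L S L⊆S with L ⊆? S
  ... | yes _   = _
  ... | no  L⊈S = L⊈S L⊆S

  ⊆ᵇ-trans : ∀ {v} (L S U : Subset v) → T (L ⊆ᵇ S) → T (S ⊆ᵇ U) → T (L ⊆ᵇ U)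
  ⊆ᵇ-trans L S U L⊆S S⊆U = ⊆⇒⊆ᵇ L U (⊆-trans (⊆ᵇ⇒⊆ L S L⊆S) (⊆ᵇ⇒⊆ S U S⊆U))

  ⊆ᵇ⇒∣∣≤ : ∀ {v} (L S : Subset v) → T (L ⊆ᵇ S) → ∣ L ∣ ≤ ∣ S ∣
  ⊆ᵇ⇒∣∣≤ L S L⊆S = p⊆q⇒∣p∣≤∣q∣ (⊆ᵇ⇒⊆ L S L⊆S)

  ⊆ᵇ⇒∣∣+∣─∣ : ∀ {v} (L U : Subset v) → T (L ⊆ᵇ U) → ∣ L ∣ + ∣ U ─ L ∣ ≡ ∣ U ∣
  ⊆ᵇ⇒∣∣+∣─∣ []          []          _   = refl
  ⊆ᵇ⇒∣∣+∣─∣ (true ∷ L)  (true ∷ U)  L⊆U = cong suc (⊆ᵇ⇒∣∣+∣─∣ L U L⊆U)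
  ⊆ᵇ⇒∣∣+∣─∣ (false ∷ L) (true ∷ U)  L⊆U = trans (ℕ.+-suc ∣ L ∣ _) (cong suc (⊆ᵇ⇒∣∣+∣─∣ L U L⊆U))
  ⊆ᵇ⇒∣∣+∣─∣ (false ∷ L) (false ∷ U) L⊆U = ⊆ᵇ⇒∣∣+∣─∣ L U L⊆U

  ⊆ᵇ-∩ : ∀ {v} (S B B′ : Subset v) → S ⊆ᵇ (B ∩ B′) ≡ (S ⊆ᵇ B ∧ S ⊆ᵇ B′)
  ⊆ᵇ-∩ []          []          []          = refl
  ⊆ᵇ-∩ (true ∷ S)  (true ∷ B)  (true ∷ B′) = ⊆ᵇ-∩ S B B′
  ⊆ᵇ-∩ (true ∷ S)  (true ∷ B)  (false ∷ B′) = sym (∧-zeroʳ (S ⊆ᵇ B))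
  ⊆ᵇ-∩ (true ∷ S)  (false ∷ B) (b′ ∷ B′)   = refl
  ⊆ᵇ-∩ (false ∷ S) (b ∷ B)     (b′ ∷ B′)   = ⊆ᵇ-∩ S B B′

  ⊆ᵇ-⊤ : ∀ {v} (S : Subset v) → T (S ⊆ᵇ ⊤)
  ⊆ᵇ-⊤ S = ⊆⇒⊆ᵇ S ⊤ ⊆⊤

  ∅-⊆ᵇ : ∀ {v} (S : Subset v) → T (∅ ⊆ᵇ S)
  ∅-⊆ᵇ S = ⊆⇒⊆ᵇ ∅ S ⊥⊆

  allSubsets : ∀ v → List (Subset v)
  allSubsets zero    = [] ∷ []
  allSubsets (suc v) = map (inside ∷_) (allSubsets v) ++ map (outside ∷_) (allSubsets v)

  ∑-allSubsets : ∀ v (f : Subset (suc v) → ℕ) →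
                 ∑ (allSubsets (suc v)) f ≡ ∑ (allSubsets v) (f ∘ (inside ∷_)) + ∑ (allSubsets v) (f ∘ (outside ∷_))
  ∑-allSubsets v f = trans (∑-++ (map (inside ∷_) (allSubsets v)) _ f)
                           (cong₂ _+_ (∑-map (inside ∷_) (allSubsets v) f) (∑-map (outside ∷_) (allSubsets v) f))

  between : ∀ {v} → ℕ → Subset v → Subset v → Subset v → Bool
  between r L U S = (L ⊆ᵇ S ∧ (∣ S ∣ ≡ᵇ r)) ∧ S ⊆ᵇ U

  between⇒∣∣≡ : ∀ {v} r (L U S : Subset v) → T (between r L U S) → ∣ S ∣ ≡ r
  between⇒∣∣≡ r L U S h with L ⊆ᵇ S | ∣ S ∣ ≡ᵇ r in eq | S ⊆ᵇ U
  ... | true | true | true = ℕ.≡ᵇ⇒≡ ∣ S ∣ r (subst T (sym eq) _)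

  between⇒⊆ᵇ : ∀ {v} r (L U S : Subset v) → T (between r L U S) → T (L ⊆ᵇ U)
  between⇒⊆ᵇ r L U S h with L ⊆ᵇ S in L⊆S | ∣ S ∣ ≡ᵇ r | S ⊆ᵇ U in S⊆U
  ... | true | true | true = ⊆ᵇ-trans L S U (subst T (sym L⊆S) _) (subst T (sym S⊆U) _)

  countBetween : ∀ {v} → ℕ → Subset v → Subset v → ℕ
  countBetween {v} r L U = ∑ (allSubsets v) (𝟙 ∘ between r L U)

  countBetween-C : ∀ {v} (L U : Subset v) → T (L ⊆ᵇ U) → ∀ q → countBetween (∣ L ∣ + q) L U ≡ ∣ U ─ L ∣ C q
  countBetween-C []          []          _   zero    = refl
  countBetween-C []          []          _   (suc q) = refl
  countBetween-C {suc v} (true ∷ L) (true ∷ U) L⊆U q = begin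
    countBetween (suc ∣ L ∣ + q) (true ∷ L) (true ∷ U)         ≡⟨ ∑-allSubsets v _ ⟩
    countBetween (∣ L ∣ + q) L U + ∑ (allSubsets v) (λ _ → 0)  ≡⟨ cong (countBetween (∣ L ∣ + q) L U +_) (∑-zero (allSubsets v)) ⟩
    countBetween (∣ L ∣ + q) L U + 0                           ≡⟨ ℕ.+-identityʳ _ ⟩
    countBetween (∣ L ∣ + q) L U                               ≡⟨ countBetween-C L U L⊆U q ⟩
    ∣ U ─ L ∣ C q                                              ∎
    where open ≡-Reasoning
  countBetween-C {suc v} (false ∷ L) (true ∷ U) L⊆U zero = begin
    countBetween (∣ L ∣ + 0) (false ∷ L) (true ∷ U) ≡⟨ ∑-allSubsets v _ ⟩
    ∑ (allSubsets v) (λ S → 𝟙 ((L ⊆ᵇ S ∧ (suc ∣ S ∣ ≡ᵇ ∣ L ∣ + 0)) ∧ S ⊆ᵇ U)) + countBetween (∣ L ∣ + 0) L U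
      ≡⟨ cong₂ _+_ (trans (∑-cong (allSubsets v) too-small) (∑-zero (allSubsets v))) (countBetween-C L U L⊆U 0) ⟩
    1 ∎
    where
    open ≡-Reasoning
    too-small : ∀ S → 𝟙 ((L ⊆ᵇ S ∧ (suc ∣ S ∣ ≡ᵇ ∣ L ∣ + 0)) ∧ S ⊆ᵇ U) ≡ 0
    too-small S with L ⊆ᵇ S in L⊆S
    ... | false = refl
    ... | true with suc ∣ S ∣ ≡ᵇ ∣ L ∣ + 0 in eq
    ...   | false = refl
    ...   | true  = contradiction (subst (_≤ ∣ S ∣) (sym (ℕ.≡ᵇ⇒≡ _ _ (subst T (sym eq) _))) ∣L∣+0≤∣S∣) (ℕ.n≮n ∣ S ∣)
      where
      ∣L∣+0≤∣S∣ : ∣ L ∣ + 0 ≤ ∣ S ∣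
      ∣L∣+0≤∣S∣ = subst (_≤ ∣ S ∣) (sym (ℕ.+-identityʳ ∣ L ∣)) (⊆ᵇ⇒∣∣≤ L S (subst T (sym L⊆S) _))
  countBetween-C {suc v} (false ∷ L) (true ∷ U) L⊆U (suc q) = begin
    countBetween (∣ L ∣ + suc q) (false ∷ L) (true ∷ U) ≡⟨ ∑-allSubsets v _ ⟩
    ∑ (allSubsets v) (λ S → 𝟙 ((L ⊆ᵇ S ∧ (suc ∣ S ∣ ≡ᵇ ∣ L ∣ + suc q)) ∧ S ⊆ᵇ U)) + countBetween (∣ L ∣ + suc q) L U
      ≡⟨ cong (λ r → ∑ (allSubsets v) (λ S → 𝟙 ((L ⊆ᵇ S ∧ (suc ∣ S ∣ ≡ᵇ r)) ∧ S ⊆ᵇ U)) + countBetween (∣ L ∣ + suc q) L U) (ℕ.+-suc ∣ L ∣ q) ⟩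
    countBetween (∣ L ∣ + q) L U + countBetween (∣ L ∣ + suc q) L U
      ≡⟨ cong₂ _+_ (countBetween-C L U L⊆U q) (countBetween-C L U L⊆U (suc q)) ⟩
    ∣ U ─ L ∣ C q + ∣ U ─ L ∣ C suc q
      ≡⟨ nCk+nC[k+1]≡[n+1]C[k+1] ∣ U ─ L ∣ q ⟩
    suc ∣ U ─ L ∣ C suc q ∎
    where open ≡-Reasoning
  countBetween-C {suc v} (false ∷ L) (false ∷ U) L⊆U q = begin
    countBetween (∣ L ∣ + q) (false ∷ L) (false ∷ U) ≡⟨ ∑-allSubsets v _ ⟩
    ∑ (allSubsets v) (λ S → 𝟙 ((L ⊆ᵇ S ∧ (suc ∣ S ∣ ≡ᵇ ∣ L ∣ + q)) ∧ false)) + countBetween (∣ L ∣ + q) L U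
      ≡⟨ cong₂ _+_ (trans (∑-cong (allSubsets v) (λ S → cong 𝟙 (∧-zeroʳ _))) (∑-zero (allSubsets v)))
                   (countBetween-C L U L⊆U q) ⟩
    ∣ U ─ L ∣ C q ∎
    where open ≡-Reasoning

  countBetween-∸ : ∀ {v} (L U : Subset v) → T (L ⊆ᵇ U) → ∀ q → countBetween (∣ L ∣ + q) L U ≡ (∣ U ∣ ∸ ∣ L ∣) C q
  countBetween-∸ L U L⊆U q = begin
    countBetween (∣ L ∣ + q) L U  ≡⟨ countBetween-C L U L⊆U q ⟩
    ∣ U ─ L ∣ C q                 ≡⟨ cong (_C q) (ℕ.m+n∸m≡n ∣ L ∣ ∣ U ─ L ∣) ⟨
    (∣ L ∣ + ∣ U ─ L ∣ ∸ ∣ L ∣) C q ≡⟨ cong (λ u → (u ∸ ∣ L ∣) C q) (⊆ᵇ⇒∣∣+∣─∣ L U L⊆U) ⟩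
    (∣ U ∣ ∸ ∣ L ∣) C q           ∎
    where open ≡-Reasoning

  countBetween-⊈ : ∀ {v} r (L U : Subset v) → ¬ T (L ⊆ᵇ U) → countBetween r L U ≡ 0
  countBetween-⊈ {v} r L U L⊈U = trans (∑-cong (allSubsets v) vanish) (∑-zero (allSubsets v))
    where
    vanish : ∀ S → 𝟙 (between r L U S) ≡ 0
    vanish S with between r L U S in eq
    ... | false = refl
    ... | true  = contradiction (between⇒⊆ᵇ r L U S (subst T (sym eq) _)) L⊈U

  countBetween-∅ : ∀ {v} s (U : Subset v) → countBetween s ∅ U ≡ ∣ U ∣ C s
  countBetween-∅ {v} s U = begin
    countBetween s ∅ U             ≡⟨ cong (λ r → countBetween r ∅ U) (cong (_+ s) (∣⊥∣≡0 v)) ⟨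
    countBetween (∣ ∅ {v} ∣ + s) ∅ U ≡⟨ countBetween-∸ ∅ U (∅-⊆ᵇ U) s ⟩
    (∣ U ∣ ∸ ∣ ∅ {v} ∣) C s        ≡⟨ cong (λ z → (∣ U ∣ ∸ z) C s) (∣⊥∣≡0 v) ⟩
    ∣ U ∣ C s                      ∎
    where open ≡-Reasoning

  countBetween-block : ∀ {v k} (S B : Subset v) → ∣ B ∣ ≡ k → ∀ q →
                       countBetween (∣ S ∣ + q) S B ≡ 𝟙 (S ⊆ᵇ B) * ((k ∸ ∣ S ∣) C q)
  countBetween-block S B refl q with S ⊆ᵇ B in S⊆B
  ... | true  = trans (countBetween-∸ S B (subst T (sym S⊆B) _) q) (sym (ℕ.+-identityʳ _))
  ... | false = countBetween-⊈ _ S B (subst T S⊆B)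

  blocksThrough : ∀ {v} → Subset v → List (Subset v) → ℕ
  blocksThrough S D = ∑ D (λ B → 𝟙 (S ⊆ᵇ B))

  countContaining≡blocksThrough : ∀ {v} (S : Subset v) D → countContaining S D ≡ blocksThrough S D
  countContaining≡blocksThrough S []      = refl
  countContaining≡blocksThrough S (B ∷ D) with does (S ⊆? B)
  ... | true  = cong suc (countContaining≡blocksThrough S D)
  ... | false = countContaining≡blocksThrough S D

  ∑-countBetween-∩ : ∀ {v} r (L U : Subset v) D →
                     ∑ D (λ B → countBetween r L (U ∩ B)) ≡ ∑ (allSubsets v) (λ S → 𝟙 (between r L U S) * blocksThrough S D)
  ∑-countBetween-∩ {v} r L U D = trans (∑-cong D (λ B → ∑-cong (allSubsets v) (split B))) (∑-double (allSubsets v) D (𝟙 ∘ between r L U) (λ S B → 𝟙 (S ⊆ᵇ B)))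
    where
    split : ∀ B S → 𝟙 (between r L (U ∩ B) S) ≡ 𝟙 (between r L U S) * 𝟙 (S ⊆ᵇ B)
    split B S = begin
      𝟙 ((L ⊆ᵇ S ∧ (∣ S ∣ ≡ᵇ r)) ∧ S ⊆ᵇ (U ∩ B))          ≡⟨ cong (λ b → 𝟙 ((L ⊆ᵇ S ∧ (∣ S ∣ ≡ᵇ r)) ∧ b)) (⊆ᵇ-∩ S U B) ⟩
      𝟙 ((L ⊆ᵇ S ∧ (∣ S ∣ ≡ᵇ r)) ∧ (S ⊆ᵇ U ∧ S ⊆ᵇ B))    ≡⟨ cong 𝟙 (∧-assoc _ (S ⊆ᵇ U) (S ⊆ᵇ B)) ⟨
      𝟙 (between r L U S ∧ S ⊆ᵇ B)                      ≡⟨ 𝟙-∧ (between r L U S) (S ⊆ᵇ B) ⟩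
      𝟙 (between r L U S) * 𝟙 (S ⊆ᵇ B)                  ∎
      where open ≡-Reasoning

  ∑-between-uniform : ∀ {v} r (L U : Subset v) (w : Subset v → ℕ) c → (∀ S → ∣ S ∣ ≡ r → w S ≡ c) →
                      ∑ (allSubsets v) (λ S → 𝟙 (between r L U S) * w S) ≡ countBetween r L U * c
  ∑-between-uniform {v} r L U w c w≡c = trans (∑-cong (allSubsets v) uniform) (∑-*ʳ (allSubsets v) _ c)
    where
    uniform : ∀ S → 𝟙 (between r L U S) * w S ≡ 𝟙 (between r L U S) * c
    uniform S with between r L U S in eq
    ... | false = refl
    ... | true  = cong (1 *_) (w≡c S (between⇒∣∣≡ r L U S (subst T (sym eq) _)))

  blocksThrough-design : ∀ {t v k lam D} → IsDesign t v k lam D → ∀ (S : Subset v) q → ∣ S ∣ + q ≡ t →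
                         blocksThrough S D * ((k ∸ ∣ S ∣) C q) ≡ lam * ((v ∸ ∣ S ∣) C q)
  blocksThrough-design {t} {v} {k} {lam} {D} (_ , blocks-of-size-k , t-sets-in-lam) S q s+q≡t = begin
    blocksThrough S D * ((k ∸ ∣ S ∣) C q)
      ≡⟨ ∑-*ʳ D _ _ ⟨
    ∑ D (λ B → 𝟙 (S ⊆ᵇ B) * ((k ∸ ∣ S ∣) C q))
      ≡⟨ ∑-congᴬ D blocks-of-size-k (λ B ∣B∣≡k → trans (in-block B) (countBetween-block S B ∣B∣≡k q)) ⟨
    ∑ D (λ B → countBetween t S (⊤ ∩ B))
      ≡⟨ ∑-countBetween-∩ t S ⊤ D ⟩
    ∑ (allSubsets v) (λ S′ → 𝟙 (between t S ⊤ S′) * blocksThrough S′ D)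
      ≡⟨ ∑-between-uniform t S ⊤ _ lam (λ S′ ∣S′∣≡t → trans (sym (countContaining≡blocksThrough S′ D)) (t-sets-in-lam S′ ∣S′∣≡t)) ⟩
    countBetween t S ⊤ * lam
      ≡⟨ cong (_* lam) (trans (cong (λ r → countBetween r S ⊤) (sym s+q≡t)) (countBetween-∸ S ⊤ (⊆ᵇ-⊤ S) q)) ⟩
    ((∣ ⊤ {v} ∣ ∸ ∣ S ∣) C q) * lam
      ≡⟨ trans (cong (λ u → ((u ∸ ∣ S ∣) C q) * lam) (∣⊤∣≡n v)) (ℕ.*-comm _ lam) ⟩
    lam * ((v ∸ ∣ S ∣) C q) ∎
    where
    open ≡-Reasoning
    in-block : ∀ B → countBetween t S (⊤ ∩ B) ≡ countBetween (∣ S ∣ + q) S B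
    in-block B = cong₂ (λ r U → countBetween r S U) (sym s+q≡t) (∩-identityˡ B)

  ∑-intersections : ∀ {v} (D : List (Subset v)) (B : Subset v) s r → (∀ S → ∣ S ∣ ≡ s → blocksThrough S D ≡ r) →
                    ∑ D (λ B′ → ∣ B ∩ B′ ∣ C s) ≡ (∣ B ∣ C s) * r
  ∑-intersections {v} D B s r uniform = begin
    ∑ D (λ B′ → ∣ B ∩ B′ ∣ C s)
      ≡⟨ ∑-cong D (λ B′ → countBetween-∅ s (B ∩ B′)) ⟨
    ∑ D (λ B′ → countBetween s ∅ (B ∩ B′))
      ≡⟨ ∑-countBetween-∩ s ∅ B D ⟩
    ∑ (allSubsets v) (λ S → 𝟙 (between s ∅ B S) * blocksThrough S D)
      ≡⟨ ∑-between-uniform s ∅ B _ r uniform ⟩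
    countBetween s ∅ B * r
      ≡⟨ cong (_* r) (countBetween-∅ s B) ⟩
    (∣ B ∣ C s) * r ∎
    where open ≡-Reasoning

  subset-of-size : ∀ {v} r → r ≤ v → Σ (Subset v) (λ S → ∣ S ∣ ≡ r)
  subset-of-size {v}     zero    _         = ∅ , ∣⊥∣≡0 v
  subset-of-size {suc v} (suc r) (s≤s r≤v) = Product.map (inside ∷_) (cong suc) (subset-of-size r r≤v)

  ∑-filter-≤ : ∀ {A : Set} {P : A → Set} (P? : Decidable P) (xs : List A) (g : A → ℕ) → ∑ (filter P? xs) g ≤ ∑ xs g
  ∑-filter-≤ P? []       g = z≤n
  ∑-filter-≤ P? (x ∷ xs) g with does (P? x)
  ... | true  = ℕ.+-monoʳ-≤ (g x) (∑-filter-≤ P? xs g)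
  ... | false = ℕ.≤-trans (∑-filter-≤ P? xs g) (ℕ.m≤n+m _ (g x))

open SubsetCounting

open import Data.Empty using (⊥)
open import Data.Integer as ℤ using (ℤ; +_; -[1+_]; -_; _+_; _-_; _*_; NonZero)
import Data.Integer.Properties as ℤ
open import Data.Integer.Tactic.RingSolver using (solve-∀)
open import Data.List.Relation.Unary.Any using (here; there)
open import Data.List.Membership.Propositional using (_∈_)
open import Data.List.Membership.Propositional.Properties using (∈-filter⁻)
open import Data.Nat.Divisibility using (_∣_; divides; quotient; ∣m⇒∣m*n; ∣n⇒∣m*n)
open import Data.Nat.DivMod using (_%_; _/_; m≡m%n+[m/n]*n; m%n<n)
open import Data.Nat.Tactic.RingSolver using () renaming (solve-∀ to ℕ-solve-∀)

open ListSum ℤ.+-*-commutativeSemiring using ()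
  renaming (∑ to ∑ℤ; ∑-cong to ∑ℤ-cong; ∑-*ˡ to ∑ℤ-*ˡ; ∑-swap to ∑ℤ-swap)

-- The INLINE pragmas let the ring solver see through these abbreviations.

F₁ F₂ F₃ F₄ : ℤ → ℤ
F₁ X = X
F₂ X = X * (X - + 1)
F₃ X = X * (X - + 1) * (X - + 2)
F₄ X = X * (X - + 1) * (X - + 2) * (X - + 3)
{-# INLINE F₁ #-}
{-# INLINE F₂ #-}
{-# INLINE F₃ #-}
{-# INLINE F₄ #-}

falling : ℤ → ℕ → ℤ
falling X 0 = + 1
falling X 1 = F₁ X
falling X 2 = F₂ X
falling X 3 = F₃ X
falling X _ = F₄ X

falling-pascal : ∀ X j → j ℕ.< 4 → falling (X + + 1) (suc j) ≡ + suc j * falling X j + falling X (suc j)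
falling-pascal X 0 _ = pascal₁ X
  where pascal₁ : ∀ X → F₁ (X + + 1) ≡ + 1 * + 1 + F₁ X
        pascal₁ = solve-∀
falling-pascal X 1 _ = pascal₂ X
  where pascal₂ : ∀ X → F₂ (X + + 1) ≡ + 2 * F₁ X + F₂ X
        pascal₂ = solve-∀
falling-pascal X 2 _ = pascal₃ X
  where pascal₃ : ∀ X → F₃ (X + + 1) ≡ + 3 * F₂ X + F₃ X
        pascal₃ = solve-∀
falling-pascal X 3 _ = pascal₄ X
  where pascal₄ : ∀ X → F₄ (X + + 1) ≡ + 4 * F₃ X + F₄ X
        pascal₄ = solve-∀
falling-pascal X (suc (suc (suc (suc j)))) (s≤s (s≤s (s≤s (s≤s ()))))

+suc : ∀ x → + suc x ≡ + x + + 1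
+suc x = trans (ℤ.pos-+ 1 x) (ℤ.+-comm (+ 1) (+ x))

falling-C : ∀ x j → j ≤ 4 → + (j !) * + (x C j) ≡ falling (+ x) j
falling-C x       zero    _ = refl
falling-C zero    1       _ = refl
falling-C zero    2       _ = refl
falling-C zero    3       _ = refl
falling-C zero    (suc (suc (suc (suc j)))) _ = ℤ.*-zeroʳ (+ (suc (suc (suc (suc j))) !))
falling-C (suc x) (suc j) j<4 = begin
  + (suc j !) * + (suc x C suc j)
    ≡⟨ cong (λ c → + (suc j !) * + c) (nCk+nC[k+1]≡[n+1]C[k+1] x j) ⟨
  + (suc j !) * (+ (x C j) + + (x C suc j))
    ≡⟨ ℤ.*-distribˡ-+ (+ (suc j !)) (+ (x C j)) (+ (x C suc j)) ⟩
  + (suc j !) * + (x C j) + + (suc j !) * + (x C suc j)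
    ≡⟨ cong (_+ + (suc j !) * + (x C suc j)) (trans (cong (_* + (x C j)) (ℤ.pos-* (suc j) (j !))) (ℤ.*-assoc (+ suc j) (+ (j !)) (+ (x C j)))) ⟩
  + suc j * (+ (j !) * + (x C j)) + + (suc j !) * + (x C suc j)
    ≡⟨ cong₂ (λ a b → + suc j * a + b) (falling-C x j (ℕ.<⇒≤ j<4)) (falling-C x (suc j) j<4) ⟩
  + suc j * falling (+ x) j + falling (+ x) (suc j)
    ≡⟨ falling-pascal (+ x) j j<4 ⟨
  falling (+ x + + 1) (suc j)
    ≡⟨ cong (λ X → falling X (suc j)) (+suc x) ⟨
  falling (+ suc x) (suc j) ∎
  where open ≡-Reasoning

Fᵈ₂ Fᵈ₃ Fᵈ₄ : ℤ → ℤ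
Fᵈ₂ Z = Z * (Z - + 2)
Fᵈ₃ Z = Z * (Z - + 2) * (Z - + 4)
Fᵈ₄ Z = Z * (Z - + 2) * (Z - + 4) * (Z - + 6)
{-# INLINE Fᵈ₂ #-}
{-# INLINE Fᵈ₃ #-}
{-# INLINE Fᵈ₄ #-}

-- fallingᵈ (2x) j = 2ʲ · falling x j: in this form 2·C(n,2) = n(n−1) can be substituted for 2m.
fallingᵈ : ℤ → ℕ → ℤ
fallingᵈ Z 0 = + 1
fallingᵈ Z 1 = Z
fallingᵈ Z 2 = Fᵈ₂ Z
fallingᵈ Z 3 = Fᵈ₃ Z
fallingᵈ Z _ = Fᵈ₄ Z

fallingᵈ-C : ∀ x j → j ≤ 4 → + (2 ℕ.^ j ℕ.* j !) * + (x C j) ≡ fallingᵈ (+ 2 * + x) j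
fallingᵈ-C x j j≤4 = begin
  + (2 ℕ.^ j ℕ.* j !) * + (x C j)      ≡⟨ trans (cong (_* + (x C j)) (ℤ.pos-* (2 ℕ.^ j) (j !))) (ℤ.*-assoc (+ (2 ℕ.^ j)) _ _) ⟩
  + (2 ℕ.^ j) * (+ (j !) * + (x C j))  ≡⟨ cong (+ (2 ℕ.^ j) *_) (falling-C x j j≤4) ⟩
  + (2 ℕ.^ j) * falling (+ x) j        ≡⟨ doubling (+ x) j j≤4 ⟩
  fallingᵈ (+ 2 * + x) j               ∎
  where
  open ≡-Reasoning
  doubling : ∀ X j → j ≤ 4 → + (2 ℕ.^ j) * falling X j ≡ fallingᵈ (+ 2 * X) j
  doubling X 0 _ = refl
  doubling X 1 _ = refl
  doubling X 2 _ = double₂ X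
    where double₂ : ∀ X → + 4 * F₂ X ≡ Fᵈ₂ (+ 2 * X)
          double₂ = solve-∀
  doubling X 3 _ = double₃ X
    where double₃ : ∀ X → + 8 * F₃ X ≡ Fᵈ₃ (+ 2 * X)
          double₃ = solve-∀
  doubling X 4 _ = double₄ X
    where double₄ : ∀ X → + 16 * F₄ X ≡ Fᵈ₄ (+ 2 * X)
          double₄ = solve-∀
  doubling X (suc (suc (suc (suc (suc j))))) (s≤s (s≤s (s≤s (s≤s ()))))

-- Reduces c·l = t·b to the single polynomial identity P·L·u = Q·w, once p·c, d·l and q·b are
-- known as polynomials P, L, Q and the constants satisfy q·w = t·p·d·u.
cancel-scaled : ∀ {c l b : ℕ} t (p d q u w : ℤ) {P L Q : ℤ} .{{_ : NonZero (p * d * u)}} →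
                q * w ≡ + t * (p * d * u) → p * + c ≡ P → d * + l ≡ L → q * + b ≡ Q → P * L * u ≡ Q * w →
                c ℕ.* l ≡ t ℕ.* b
cancel-scaled {c} {l} {b} t p d q u w {P} {L} {Q} qw≡tpdu pc≡P dl≡L qb≡Q PLu≡Qw =
  ℤ.+-injective (ℤ.*-cancelʳ-≡ (+ (c ℕ.* l)) (+ (t ℕ.* b)) (p * d * u) (begin
    + (c ℕ.* l) * (p * d * u)      ≡⟨ trans (cong (_* (p * d * u)) (ℤ.pos-* c l)) (regroupˡ p d u (+ c) (+ l)) ⟩
    p * + c * (d * + l) * u        ≡⟨ cong₂ (λ P L → P * L * u) pc≡P dl≡L ⟩
    P * L * u                      ≡⟨ PLu≡Qw ⟩
    Q * w                          ≡⟨ cong (_* w) qb≡Q ⟨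
    q * + b * w                    ≡⟨ regroupʳ q w (+ b) ⟩
    + b * (q * w)                  ≡⟨ cong (+ b *_) qw≡tpdu ⟩
    + b * (+ t * (p * d * u))      ≡⟨ regroupᵗ (+ b) (+ t) (p * d * u) ⟩
    + t * + b * (p * d * u)        ≡⟨ cong (_* (p * d * u)) (ℤ.pos-* t b) ⟨
    + (t ℕ.* b) * (p * d * u)      ∎))
  where
  open ≡-Reasoning
  regroupˡ : ∀ p d u c l → c * l * (p * d * u) ≡ p * c * (d * l) * u
  regroupˡ = solve-∀
  regroupʳ : ∀ q w b → q * b * w ≡ b * (q * w)
  regroupʳ = solve-∀
  regroupᵗ : ∀ b t K → b * (t * K) ≡ t * b * K
  regroupᵗ = solve-∀

product-scaled : ∀ {x y : ℕ} (e p q : ℤ) {X Z : ℤ} → p * + x ≡ X → q * + y ≡ Z → e * p * q * + (x ℕ.* y) ≡ e * X * Z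
product-scaled {x} {y} e p q {X} {Z} px≡X qy≡Z = begin
  e * p * q * + (x ℕ.* y)   ≡⟨ trans (cong (e * p * q *_) (ℤ.pos-* x y)) (regroup e p q (+ x) (+ y)) ⟩
  e * (p * + x) * (q * + y) ≡⟨ cong₂ (λ X Z → e * X * Z) px≡X qy≡Z ⟩
  e * X * Z                 ∎
  where
  open ≡-Reasoning
  regroup : ∀ e p q x y → e * p * q * (x * y) ≡ e * (p * x) * (q * y)
  regroup = solve-∀

binomial24 : ℤ → ℕ → ℤ
binomial24 X 0 = + 24
binomial24 X 1 = + 24 * X
binomial24 X 2 = + 12 * F₂ X
binomial24 X 3 = + 4 * F₃ X
binomial24 X _ = F₄ X

24·C : ∀ x s → s ≤ 4 → + 24 * + (x C s) ≡ binomial24 (+ x) s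
24·C x 0 _   = refl
24·C x 1 s≤4 = trans (ℤ.*-assoc (+ 24) (+ 1) (+ (x C 1))) (cong (+ 24 *_) (falling-C x 1 s≤4))
24·C x 2 s≤4 = trans (ℤ.*-assoc (+ 12) (+ 2) (+ (x C 2))) (cong (+ 12 *_) (falling-C x 2 s≤4))
24·C x 3 s≤4 = trans (ℤ.*-assoc (+ 4) (+ 6) (+ (x C 3))) (cong (+ 4 *_) (falling-C x 3 s≤4))
24·C x 4 s≤4 = falling-C x 4 s≤4
24·C x (suc (suc (suc (suc (suc s))))) (s≤s (s≤s (s≤s (s≤s ()))))

sq : ℤ → ℤ
sq z = z * z
{-# INLINE sq #-}

Y : ℤ → ℤ
Y N = N * (N - + 1)
{-# INLINE Y #-}

f : ℤ → ℤ → ℤ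
f N J = (Y N - + 2) * J * J - (+ 5 * Y N - + 2) * J + + 4 * N * (N + + 1)
{-# INLINE f #-}

Δ⁰ Δ¹ Δ² Δ³ Δ⁴ : ℤ → ℤ
Δ⁰ N = + 16 * N * N * (N + + 1) * (N + + 1)
Δ¹ N = - (+ 16 * N * N * (N + + 3) * (N - + 1))
Δ² N = + 4 * (+ 5 * N * N * N * N - + 2 * N * N * N + N * N - + 20 * N + + 4)
Δ³ N = - (+ 24 * (Y N - + 2) * (Y N + + 2))
Δ⁴ N = + 24 * (Y N - + 2) * (Y N - + 2)
{-# INLINE Δ⁰ #-}
{-# INLINE Δ¹ #-}
{-# INLINE Δ² #-}
{-# INLINE Δ³ #-}
{-# INLINE Δ⁴ #-}

-- Newton's forward differences at 0 of J ↦ f(N,J)², a polynomial of degree 4 in J.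
Δ : ℤ → ℕ → ℤ
Δ N 0 = Δ⁰ N
Δ N 1 = Δ¹ N
Δ N 2 = Δ² N
Δ N 3 = Δ³ N
Δ N 4 = Δ⁴ N
Δ N _ = + 0

Δ-*-cong : ∀ N s {a b : ℤ} → (s ≤ 4 → a ≡ b) → Δ N s * a ≡ Δ N s * b
Δ-*-cong N 0 a≡b = cong (Δ N 0 *_) (a≡b z≤n)
Δ-*-cong N 1 a≡b = cong (Δ N 1 *_) (a≡b (s≤s z≤n))
Δ-*-cong N 2 a≡b = cong (Δ N 2 *_) (a≡b (s≤s (s≤s z≤n)))
Δ-*-cong N 3 a≡b = cong (Δ N 3 *_) (a≡b (s≤s (s≤s (s≤s z≤n))))
Δ-*-cong N 4 a≡b = cong (Δ N 4 *_) (a≡b (s≤s (s≤s (s≤s (s≤s z≤n)))))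
Δ-*-cong N (suc (suc (suc (suc (suc s))))) _ = refl


sq-f-newton : ∀ N j → sq (f N (+ j)) ≡ ∑ℤ (upTo 5) (λ s → Δ N s * + (j C s))
sq-f-newton N j = ℤ.*-cancelˡ-≡ (+ 24) (sq (f N (+ j))) (∑ℤ (upTo 5) (λ s → Δ N s * + (j C s))) (begin
  + 24 * sq (f N (+ j))                              ≡⟨ expansion N (+ j) ⟩
  ∑ℤ (upTo 5) (λ s → Δ N s * binomial24 (+ j) s)     ≡⟨ ∑ℤ-cong (upTo 5) (λ s → Δ-*-cong N s (λ s≤4 → sym (24·C j s s≤4))) ⟩
  ∑ℤ (upTo 5) (λ s → Δ N s * (+ 24 * + (j C s)))     ≡⟨ ∑ℤ-cong (upTo 5) (λ s → x[yz]≡y[xz] (Δ N s) (+ 24) (+ (j C s))) ⟩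
  ∑ℤ (upTo 5) (λ s → + 24 * (Δ N s * + (j C s)))     ≡⟨ ∑ℤ-*ˡ (upTo 5) (+ 24) (λ s → Δ N s * + (j C s)) ⟩
  + 24 * ∑ℤ (upTo 5) (λ s → Δ N s * + (j C s))       ∎)
  where
  open ≡-Reasoning
  expansion : ∀ N J → + 24 * sq (f N J) ≡
              Δ⁰ N * + 24 + (Δ¹ N * (+ 24 * J) + (Δ² N * (+ 12 * F₂ J) + (Δ³ N * (+ 4 * F₃ J) + (Δ⁴ N * F₄ J + + 0))))
  expansion = solve-∀
  x[yz]≡y[xz] : ∀ x y z → x * (y * z) ≡ y * (x * z)
  x[yz]≡y[xz] = solve-∀

momentPolynomial : ℤ → ℕ → ℤ
momentPolynomial N 0 = + 12 * Fᵈ₂ (Y N + + 4) * + 1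
momentPolynomial N 1 = + 24 * ((Y N + + 2) * (N + + 1)) * (N + + 1)
momentPolynomial N 2 = + 24 * F₂ (N + + 1) * F₂ (N + + 1)
momentPolynomial N 3 = + 16 * (N + + 1) * F₃ (N + + 1)
momentPolynomial N _ = + 4 * + 2 * F₄ (N + + 1)

key-identity : ∀ N → ∑ℤ (upTo 5) (λ s → Δ N s * momentPolynomial N s) ≡ + 96 * sq (f N (N + + 1))
key-identity N = identity N
  where
  identity : ∀ N →
    Δ⁰ N * (+ 12 * Fᵈ₂ (Y N + + 4) * + 1) +
    (Δ¹ N * (+ 24 * ((Y N + + 2) * (N + + 1)) * (N + + 1)) +
    (Δ² N * (+ 24 * F₂ (N + + 1) * F₂ (N + + 1)) +
    (Δ³ N * (+ 16 * (N + + 1) * F₃ (N + + 1)) +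
    (Δ⁴ N * (+ 4 * + 2 * F₄ (N + + 1)) + + 0))))
    ≡ + 96 * sq (f N (N + + 1))
  identity = solve-∀

f-positive : ∀ p t → f (+ (5 ℕ.+ p)) (+ (4 ℕ.+ t)) ≡
             + suc (8 ℕ.* p ℕ.+ 15 ℕ.+ t ℕ.* (3 ℕ.* p ℕ.* p ℕ.+ 27 ℕ.* p ℕ.+ 46) ℕ.+ t ℕ.* t ℕ.* (p ℕ.* p ℕ.+ 9 ℕ.* p ℕ.+ 18))
f-positive p t = trans (shifted (+ p) (+ t)) (cong (λ z → + 1 + z) (sym cast))
  where
  shifted : ∀ P T → f (+ 5 + P) (+ 4 + T) ≡
            + 1 + (+ 8 * P + + 15 + T * (+ 3 * P * P + + 27 * P + + 46) + T * T * (P * P + + 9 * P + + 18))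
  shifted = solve-∀
  P = + p
  T = + t
  cast : + (8 ℕ.* p ℕ.+ 15 ℕ.+ t ℕ.* (3 ℕ.* p ℕ.* p ℕ.+ 27 ℕ.* p ℕ.+ 46) ℕ.+ t ℕ.* t ℕ.* (p ℕ.* p ℕ.+ 9 ℕ.* p ℕ.+ 18)) ≡
         + 8 * P + + 15 + T * (+ 3 * P * P + + 27 * P + + 46) + T * T * (P * P + + 9 * P + + 18)
  cast = cong₂ _+_ (cong₂ _+_ (cong (_+ + 15) (ℤ.pos-* 8 p))
                              (trans (ℤ.pos-* t _) (cong (T *_) (cong₂ (λ a b → a + b + + 46) (trans (ℤ.pos-* (3 ℕ.* p) p) (cong (_* P) (ℤ.pos-* 3 p))) (ℤ.pos-* 27 p)))))
                   (trans (ℤ.pos-* (t ℕ.* t) _) (cong₂ _*_ (ℤ.pos-* t t) (cong₂ (λ a b → a + b + + 18) (ℤ.pos-* p p) (ℤ.pos-* 9 p))))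

sq-f-positive : ∀ n j → 5 ≤ n → 4 ≤ j → 1 ≤ ℤ.∣ sq (f (+ n) (+ j)) ∣
sq-f-positive n j 5≤n 4≤j with ℕ.m≤n⇒∃[o]m+o≡n 5≤n | ℕ.m≤n⇒∃[o]m+o≡n 4≤j
... | p , refl | t , refl = subst (λ z → 1 ≤ ℤ.∣ sq z ∣) (sym (f-positive p t)) (s≤s z≤n)

+∣sq∣ : ∀ z → + ℤ.∣ sq z ∣ ≡ sq z
+∣sq∣ (+ a)    = trans (cong (λ x → + ℤ.∣ x ∣) (ℤ.+◃n≡+n (a ℕ.* a))) (sym (ℤ.+◃n≡+n (a ℕ.* a)))
+∣sq∣ -[1+ a ] = refl

+∑ : ∀ {A : Set} (xs : List A) (g : A → ℕ) → + ∑ xs g ≡ ∑ℤ xs (λ x → + g x)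
+∑ []       g = refl
+∑ (x ∷ xs) g = cong (λ z → + g x + z) (+∑ xs g)

pos-∸ : ∀ {m n} → n ≤ m → + (m ℕ.∸ n) ≡ + m - + n
pos-∸ {m} {n} n≤m = trans (sym (ℤ.⊖-≥ n≤m)) (sym (ℤ.m-n≡m⊖n m n))

C-positive : ∀ x j → j ≤ x → 0 ℕ.< x C j
C-positive x       zero    _         = s≤s z≤n
C-positive (suc x) (suc j) (s≤s j≤x) =
  subst (0 ℕ.<_) (nCk+nC[k+1]≡[n+1]C[k+1] x j) (ℕ.<-≤-trans (C-positive x j j≤x) (ℕ.m≤m+n (x C j) _))

module Parameters (n m w : ℕ) (5≤n : 5 ≤ n) (2≤m : 2 ≤ m)
                  (2m≡Y : + 2 * + m ≡ Y (+ n)) (2w≡[m+1][n+1] : 2 ℕ.* w ≡ suc m ℕ.* suc n) where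

  private
    N = + n
    1≤n : 1 ≤ n
    1≤n = ℕ.≤-trans (s≤s z≤n) 5≤n
    2≤n : 2 ≤ n
    2≤n = ℕ.≤-trans (s≤s (s≤s z≤n)) 5≤n
    1≤m : 1 ≤ m
    1≤m = ℕ.≤-trans (s≤s z≤n) 2≤m
    4≤k : 4 ≤ suc n
    4≤k = s≤s (ℕ.≤-trans (s≤s (s≤s (s≤s z≤n))) 5≤n)
    4≤4 : 4 ≤ 4
    4≤4 = ℕ.≤-refl

  double : ∀ c → + 2 * + (c ℕ.+ m) ≡ Y N + + (2 ℕ.* c)
  double c = begin
    + 2 * (+ c + + m)        ≡⟨ ℤ.*-distribˡ-+ (+ 2) (+ c) (+ m) ⟩
    + 2 * + c + + 2 * + m    ≡⟨ cong₂ _+_ (ℤ.pos-* 2 c) (sym 2m≡Y) ⟨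
    + (2 ℕ.* c) + Y N        ≡⟨ ℤ.+-comm (+ (2 ℕ.* c)) (Y N) ⟩
    Y N + + (2 ℕ.* c)        ∎
    where open ≡-Reasoning

  double-pred : + 2 * + (m ℕ.∸ 1) ≡ Y N - + 2
  double-pred = begin
    + 2 * + (m ℕ.∸ 1)        ≡⟨ cong (+ 2 *_) (pos-∸ 1≤m) ⟩
    + 2 * (+ m - + 1)        ≡⟨ distrib (+ m) ⟩
    + 2 * + m - + 2          ≡⟨ cong (_- + 2) 2m≡Y ⟩
    Y N - + 2                ∎
    where
    open ≡-Reasoning
    distrib : ∀ M → + 2 * (M - + 1) ≡ + 2 * M - + 2
    distrib = solve-∀

  -- λᵢ = 2·C(v−i,4−i)/C(k−i,4−i), the number of blocks through an i-set
  replication : ℕ → ℕ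
  replication 0 = suc (suc m) C 2
  replication 1 = w
  replication 2 = suc n C 2
  replication 3 = suc n
  replication _ = 2

  +k : + suc n ≡ N + + 1
  +k = +suc n

  C-k : ∀ s → s ≤ 4 → + (s !) * + (suc n C s) ≡ falling (N + + 1) s
  C-k s s≤4 = trans (falling-C (suc n) s s≤4) (cong (λ X → falling X s) +k)

  replication₀ : + 8 * + replication 0 ≡ Fᵈ₂ (Y N + + 4)
  replication₀ = trans (fallingᵈ-C (2 ℕ.+ m) 2 (s≤s (s≤s z≤n))) (cong (λ Z → fallingᵈ Z 2) (double 2))

  replication₁ : + 4 * + replication 1 ≡ (Y N + + 2) * (N + + 1)
  replication₁ = begin
    + 4 * + w                       ≡⟨ ℤ.*-assoc (+ 2) (+ 2) (+ w) ⟩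
    + 2 * (+ 2 * + w)               ≡⟨ cong (+ 2 *_) (trans (cong +_ (sym 2w≡[m+1][n+1])) (ℤ.pos-* 2 w)) ⟨
    + 2 * + (suc m ℕ.* suc n)       ≡⟨ trans (cong (+ 2 *_) (ℤ.pos-* (suc m) (suc n))) (sym (ℤ.*-assoc (+ 2) (+ suc m) (+ suc n))) ⟩
    + 2 * + (1 ℕ.+ m) * + suc n     ≡⟨ cong₂ _*_ (double 1) +k ⟩
    (Y N + + 2) * (N + + 1)         ∎
    where open ≡-Reasoning

  replication₂ : + 2 * + replication 2 ≡ F₂ (N + + 1)
  replication₂ = C-k 2 (s≤s (s≤s z≤n))

  replication₃ : + 1 * + replication 3 ≡ N + + 1
  replication₃ = trans (ℤ.*-identityˡ (+ suc n)) +k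

  replication-equation : ∀ i → i ≤ 4 → ((suc n ℕ.∸ i) C (4 ℕ.∸ i)) ℕ.* replication i ≡ 2 ℕ.* ((suc (suc m) ℕ.∸ i) C (4 ℕ.∸ i))
  replication-equation 0 _ =
    cancel-scaled {suc n C 4} {replication 0} {suc (suc m) C 4} 2 (+ 24) (+ 8) (+ 384) (+ 1) (+ 1) refl (C-k 4 4≤4) replication₀
      (trans (fallingᵈ-C (2 ℕ.+ m) 4 4≤4) (cong (λ Z → fallingᵈ Z 4) (double 2))) (identity N)
    where identity : ∀ N → F₄ (N + + 1) * Fᵈ₂ (Y N + + 4) * + 1 ≡ Fᵈ₄ (Y N + + 4) * + 1
          identity = solve-∀
  replication-equation 1 _ =
    cancel-scaled {n C 3} {replication 1} {suc m C 3} 2 (+ 6) (+ 4) (+ 48) (+ 1) (+ 1) refl (falling-C n 3 (ℕ.n≤1+n 3)) replication₁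
      (trans (fallingᵈ-C (1 ℕ.+ m) 3 (ℕ.n≤1+n 3)) (cong (λ Z → fallingᵈ Z 3) (double 1))) (identity N)
    where identity : ∀ N → F₃ N * ((Y N + + 2) * (N + + 1)) * + 1 ≡ Fᵈ₃ (Y N + + 2) * + 1
          identity = solve-∀
  replication-equation 2 _ =
    cancel-scaled {(n ℕ.∸ 1) C 2} {replication 2} {m C 2} 2 (+ 2) (+ 2) (+ 8) (+ 1) (+ 1) refl
      (trans (falling-C (n ℕ.∸ 1) 2 (s≤s (s≤s z≤n))) (cong (λ X → falling X 2) (pos-∸ 1≤n))) replication₂
      (trans (fallingᵈ-C (0 ℕ.+ m) 2 (s≤s (s≤s z≤n))) (cong (λ Z → fallingᵈ Z 2) (trans (double 0) (ℤ.+-identityʳ (Y N))))) (identity N)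
    where identity : ∀ N → F₂ (N - + 1) * F₂ (N + + 1) * + 1 ≡ Fᵈ₂ (Y N) * + 1
          identity = solve-∀
  replication-equation 3 _ =
    cancel-scaled {(n ℕ.∸ 2) C 1} {replication 3} {(m ℕ.∸ 1) C 1} 2 (+ 1) (+ 1) (+ 2) (+ 1) (+ 1) refl
      (trans (falling-C (n ℕ.∸ 2) 1 (s≤s z≤n)) (pos-∸ 2≤n)) replication₃
      (trans (fallingᵈ-C (m ℕ.∸ 1) 1 (s≤s z≤n)) double-pred) (identity N)
    where identity : ∀ N → (N - + 2) * (N + + 1) * + 1 ≡ (Y N - + 2) * + 1
          identity = solve-∀
  replication-equation 4 _ = refl
  replication-equation (suc (suc (suc (suc (suc i))))) (s≤s (s≤s (s≤s (s≤s ()))))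

  admissible : Admissible 4 (suc (suc m)) (suc n) 2
  admissible i i≤4 = divides (replication i) (begin
    b ℕ.* 2               ≡⟨ ℕ.*-comm b 2 ⟩
    2 ℕ.* b               ≡⟨ replication-equation i i≤4 ⟨
    c ℕ.* replication i   ≡⟨ ℕ.*-comm c (replication i) ⟩
    replication i ℕ.* c   ∎)
    where
    open ≡-Reasoning
    b = (suc (suc m) ℕ.∸ i) C (4 ℕ.∸ i)
    c = (suc n ℕ.∸ i) C (4 ℕ.∸ i)

  moment-polynomial : ∀ s → s ≤ 4 → + 96 * + (replication s ℕ.* (suc n C s)) ≡ momentPolynomial N s
  moment-polynomial 0 _ = product-scaled {replication 0} {suc n C 0} (+ 12) (+ 8) (+ 1) replication₀ (C-k 0 z≤n)
  moment-polynomial 1 s≤4 = product-scaled {replication 1} {suc n C 1} (+ 24) (+ 4) (+ 1) replication₁ (C-k 1 s≤4)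
  moment-polynomial 2 s≤4 = product-scaled {replication 2} {suc n C 2} (+ 24) (+ 2) (+ 2) replication₂ (C-k 2 s≤4)
  moment-polynomial 3 s≤4 = product-scaled {replication 3} {suc n C 3} (+ 16) (+ 1) (+ 6) replication₃ (C-k 3 s≤4)
  moment-polynomial 4 s≤4 = product-scaled {replication 4} {suc n C 4} (+ 4) (+ 1) (+ 24) refl (C-k 4 s≤4)
  moment-polynomial (suc (suc (suc (suc (suc s))))) (s≤s (s≤s (s≤s (s≤s ()))))

  module Design {D : List (Subset (suc (suc m)))} (design : IsDesign 4 (suc (suc m)) (suc n) 2 D) where

    blocksThrough-replication : ∀ S → ∣ S ∣ ≤ 4 → blocksThrough S D ≡ replication ∣ S ∣
    blocksThrough-replication S s≤4 = ℕ.*-cancelʳ-≡ (blocksThrough S D) (replication s) c {{ℕ.>-nonZero c>0}} (begin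
      blocksThrough S D ℕ.* c           ≡⟨ blocksThrough-design design S (4 ℕ.∸ s) (ℕ.m+[n∸m]≡n s≤4) ⟩
      2 ℕ.* ((suc (suc m) ℕ.∸ s) C (4 ℕ.∸ s)) ≡⟨ replication-equation s s≤4 ⟨
      c ℕ.* replication s               ≡⟨ ℕ.*-comm c (replication s) ⟩
      replication s ℕ.* c               ∎)
      where
      open ≡-Reasoning
      s = ∣ S ∣
      c = (suc n ℕ.∸ s) C (4 ℕ.∸ s)
      c>0 : 0 ℕ.< c
      c>0 = C-positive (suc n ℕ.∸ s) (4 ℕ.∸ s) (ℕ.∸-monoˡ-≤ s 4≤k)

    intersections : ∀ B → ∣ B ∣ ≡ suc n → ∀ s → s ≤ 4 → ∑ D (λ B′ → ∣ B ∩ B′ ∣ C s) ≡ replication s ℕ.* (suc n C s)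
    intersections B ∣B∣≡k s s≤4 = begin
      ∑ D (λ B′ → ∣ B ∩ B′ ∣ C s)      ≡⟨ ∑-intersections D B s (replication s) through-s ⟩
      (∣ B ∣ C s) ℕ.* replication s     ≡⟨ cong (λ b → (b C s) ℕ.* replication s) ∣B∣≡k ⟩
      (suc n C s) ℕ.* replication s     ≡⟨ ℕ.*-comm (suc n C s) (replication s) ⟩
      replication s ℕ.* (suc n C s)     ∎
      where
      open ≡-Reasoning
      through-s : ∀ S → ∣ S ∣ ≡ s → blocksThrough S D ≡ replication s
      through-s S refl = blocksThrough-replication S s≤4

    sum-of-squares : ∀ B → ∣ B ∣ ≡ suc n → ∑ℤ D (λ B′ → sq (f N (+ ∣ B ∩ B′ ∣))) ≡ sq (f N (N + + 1))
    sum-of-squares B ∣B∣≡k = ℤ.*-cancelˡ-≡ (+ 96) (∑ℤ D (λ B′ → sq (f N (+ meet B′)))) (sq (f N (N + + 1))) (begin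
      + 96 * ∑ℤ D (λ B′ → sq (f N (+ meet B′)))
        ≡⟨ cong (+ 96 *_) (∑ℤ-cong D (λ B′ → sq-f-newton N (meet B′))) ⟩
      + 96 * ∑ℤ D (λ B′ → ∑ℤ (upTo 5) (λ s → Δ N s * + (meet B′ C s)))
        ≡⟨ cong (+ 96 *_) (∑ℤ-swap D (upTo 5) (λ B′ s → Δ N s * + (meet B′ C s))) ⟩
      + 96 * ∑ℤ (upTo 5) (λ s → ∑ℤ D (λ B′ → Δ N s * + (meet B′ C s)))
        ≡⟨ cong (+ 96 *_) (∑ℤ-cong (upTo 5) (λ s → ∑ℤ-*ˡ D (Δ N s) (λ B′ → + (meet B′ C s)))) ⟩
      + 96 * ∑ℤ (upTo 5) (λ s → Δ N s * ∑ℤ D (λ B′ → + (meet B′ C s)))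
        ≡⟨ cong (+ 96 *_) (∑ℤ-cong (upTo 5) (λ s → Δ-*-cong N s (λ s≤4 → trans (sym (+∑ D (λ B′ → meet B′ C s))) (cong +_ (intersections B ∣B∣≡k s s≤4))))) ⟩
      + 96 * ∑ℤ (upTo 5) (λ s → Δ N s * + (replication s ℕ.* (suc n C s)))
        ≡⟨ ∑ℤ-*ˡ (upTo 5) (+ 96) (λ s → Δ N s * + (replication s ℕ.* (suc n C s))) ⟨
      ∑ℤ (upTo 5) (λ s → + 96 * (Δ N s * + (replication s ℕ.* (suc n C s))))
        ≡⟨ ∑ℤ-cong (upTo 5) (λ s → trans (x[yz]≡y[xz] (+ 96) (Δ N s) (+ (replication s ℕ.* (suc n C s)))) (Δ-*-cong N s (moment-polynomial s))) ⟩
      ∑ℤ (upTo 5) (λ s → Δ N s * momentPolynomial N s)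
        ≡⟨ key-identity N ⟩
      + 96 * sq (f N (N + + 1)) ∎)
      where
      open ≡-Reasoning
      meet : Subset (suc (suc m)) → ℕ
      meet B′ = ∣ B ∩ B′ ∣
      x[yz]≡y[xz] : ∀ x y z → x * (y * z) ≡ y * (x * z)
      x[yz]≡y[xz] = solve-∀

    no-two-blocks-through : ∀ T → ∣ T ∣ ≡ 4 → length (filter (T ⊆?_) D) ≡ 2 → ⊥
    no-two-blocks-through T ∣T∣≡4 _ with filter (T ⊆?_) D in filter≡
    ... | B ∷ B′ ∷ [] = ℕ.<-irrefl refl GB<GB
      where
      B∈D×T⊆B : B ∈ D × T ⊆ B
      B∈D×T⊆B = ∈-filter⁻ (T ⊆?_) {xs = D} (subst (B ∈_) (sym filter≡) (here refl))
      T⊆B′ : T ⊆ B′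
      T⊆B′ = proj₂ (∈-filter⁻ (T ⊆?_) {xs = D} (subst (B′ ∈_) (sym filter≡) (there (here refl))))
      4≤∣B∩B′∣ : 4 ≤ ∣ B ∩ B′ ∣
      4≤∣B∩B′∣ = subst (_≤ ∣ B ∩ B′ ∣) ∣T∣≡4 (p⊆q⇒∣p∣≤∣q∣ (λ x∈T → x∈p∩q⁺ (proj₂ B∈D×T⊆B x∈T , T⊆B′ x∈T)))
      ∣B∣≡k : ∣ B ∣ ≡ suc n
      ∣B∣≡k = All.lookup (proj₁ (proj₂ design)) (proj₁ B∈D×T⊆B)
      G : Subset (suc (suc m)) → ℕ
      G X = ℤ.∣ sq (f N (+ ∣ B ∩ X ∣)) ∣
      ∑G≡GB : ∑ D G ≡ G B
      ∑G≡GB = ℤ.+-injective (begin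
        + ∑ D G                                 ≡⟨ +∑ D G ⟩
        ∑ℤ D (λ X → + G X)                      ≡⟨ ∑ℤ-cong D (λ X → +∣sq∣ (f N (+ ∣ B ∩ X ∣))) ⟩
        ∑ℤ D (λ X → sq (f N (+ ∣ B ∩ X ∣)))     ≡⟨ sum-of-squares B ∣B∣≡k ⟩
        sq (f N (N + + 1))                      ≡⟨ cong (λ x → sq (f N x)) (trans (cong (λ X → + ∣ X ∣) (∩-idem B)) (trans (cong +_ ∣B∣≡k) +k)) ⟨
        sq (f N (+ ∣ B ∩ B ∣))                  ≡⟨ +∣sq∣ (f N (+ ∣ B ∩ B ∣)) ⟨
        + G B                                   ∎)
        where open ≡-Reasoning
      GB<GB : G B ℕ.< G B
      GB<GB = begin-strict
        G B                       <⟨ ℕ.m<m+n (G B) (sq-f-positive n (∣ B ∩ B′ ∣) 5≤n 4≤∣B∩B′∣) ⟩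
        G B ℕ.+ G B′              ≡⟨ cong (G B ℕ.+_) (ℕ.+-identityʳ (G B′)) ⟨
        ∑ (B ∷ B′ ∷ []) G         ≡⟨ cong (λ xs → ∑ xs G) filter≡ ⟨
        ∑ (filter (T ⊆?_) D) G    ≤⟨ ∑-filter-≤ (T ⊆?_) D G ⟩
        ∑ D G                     ≡⟨ ∑G≡GB ⟩
        G B                       ∎
        where open ℕ.≤-Reasoning

    no-design : ⊥
    no-design = no-two-blocks-through T₄ ∣T₄∣≡4 (proj₂ (proj₂ design) T₄ ∣T₄∣≡4)
      where
      T₄,∣T₄∣≡4 = subset-of-size {suc (suc m)} 4 (s≤s (s≤s 2≤m))
      T₄ = proj₁ T₄,∣T₄∣≡4
      ∣T₄∣≡4 = proj₂ T₄,∣T₄∣≡4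

2m≡Y⇒2≤m : ∀ n m → 5 ≤ n → + 2 * + m ≡ Y (+ n) → 2 ≤ m
2m≡Y⇒2≤m _ (suc (suc _)) _ _ = s≤s (s≤s z≤n)
2m≡Y⇒2≤m _ 0 (s≤s (s≤s (s≤s (s≤s (s≤s _))))) ()
2m≡Y⇒2≤m _ 1 (s≤s (s≤s (s≤s (s≤s (s≤s _))))) ()

[m+1][n+1]-even : ∀ n m → ¬ 4 ∣ n → 2 ℕ.* m ≡ n ℕ.* (n ℕ.∸ 1) → 2 ∣ suc m ℕ.* suc n
[m+1][n+1]-even n m 4∤n 2m≡n[n-1] with n % 4 | n / 4 | m≡m%n+[m/n]*n n 4 | m%n<n n 4
... | 0 | q | refl | _ = contradiction (divides q refl) 4∤n
... | 1 | q | refl | _ = ∣n⇒∣m*n (suc m) (divides (1 ℕ.+ q ℕ.* 2) (odd q))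
  where odd : ∀ q → 2 ℕ.+ q ℕ.* 4 ≡ (1 ℕ.+ q ℕ.* 2) ℕ.* 2
        odd = ℕ-solve-∀
... | 3 | q | refl | _ = ∣n⇒∣m*n (suc m) (divides (2 ℕ.+ q ℕ.* 2) (odd q))
  where odd : ∀ q → 4 ℕ.+ q ℕ.* 4 ≡ (2 ℕ.+ q ℕ.* 2) ℕ.* 2
        odd = ℕ-solve-∀
... | 2 | q | refl | _ = ∣m⇒∣m*n (suc n) (divides (1 ℕ.+ q ℕ.* 3 ℕ.+ q ℕ.* q ℕ.* 4) (trans (cong suc m≡) (half q)))
  where
  m≡ : m ≡ (1 ℕ.+ q ℕ.* 2) ℕ.* (1 ℕ.+ q ℕ.* 4)
  m≡ = ℕ.*-cancelˡ-≡ m _ 2 (trans 2m≡n[n-1] (double q))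
    where double : ∀ q → (2 ℕ.+ q ℕ.* 4) ℕ.* (1 ℕ.+ q ℕ.* 4) ≡ 2 ℕ.* ((1 ℕ.+ q ℕ.* 2) ℕ.* (1 ℕ.+ q ℕ.* 4))
          double = ℕ-solve-∀
  half : ∀ q → suc ((1 ℕ.+ q ℕ.* 2) ℕ.* (1 ℕ.+ q ℕ.* 4)) ≡ (1 ℕ.+ q ℕ.* 3 ℕ.+ q ℕ.* q ℕ.* 4) ℕ.* 2
  half = ℕ-solve-∀
... | suc (suc (suc (suc _))) | _ | _ | s≤s (s≤s (s≤s (s≤s ())))

2·C[n,2]≡n[n-1] : ∀ n → 1 ≤ n → 2 ℕ.* (n C 2) ≡ n ℕ.* (n ℕ.∸ 1)
2·C[n,2]≡n[n-1] n 1≤n = ℤ.+-injective (begin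
  + (2 ℕ.* (n C 2))          ≡⟨ ℤ.pos-* 2 (n C 2) ⟩
  + 2 * + (n C 2)            ≡⟨ falling-C n 2 (s≤s (s≤s z≤n)) ⟩
  + n * (+ n - + 1)          ≡⟨ cong (+ n *_) (pos-∸ 1≤n) ⟨
  + n * + (n ℕ.∸ 1)          ≡⟨ ℤ.pos-* n (n ℕ.∸ 1) ⟨
  + (n ℕ.* (n ℕ.∸ 1))        ∎)
  where open ≡-Reasoning

theorem3p3 : ∀ (n : ℕ) → 5 ≤ n → ¬ (4 ∣ n) →
    Admissible 4 (n C 2 ℕ.+ 2) (n ℕ.+ 1) 2 ×
    ¬ (∃ λ (D : List (Subset (n C 2 ℕ.+ 2))) → IsDesign 4 (n C 2 ℕ.+ 2) (n ℕ.+ 1) 2 D)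
theorem3p3 n 5≤n 4∤n =
  subst₂ (λ v k → Admissible 4 v k 2 × ¬ (∃ λ (D : List (Subset v)) → IsDesign 4 v k 2 D))
         (ℕ.+-comm 2 m) (ℕ.+-comm 1 n)
         (admissible , λ (_ , design) → Design.no-design design)
  where
  m = n C 2
  2m≡Y : + 2 * + m ≡ Y (+ n)
  2m≡Y = falling-C n 2 (s≤s (s≤s z≤n))
  2∣[m+1][n+1] : 2 ∣ suc m ℕ.* suc n
  2∣[m+1][n+1] = [m+1][n+1]-even n m 4∤n (2·C[n,2]≡n[n-1] n (ℕ.≤-trans (s≤s z≤n) 5≤n))
  w = quotient 2∣[m+1][n+1]
  open Parameters n m w 5≤n (2m≡Y⇒2≤m n m 5≤n 2m≡Y) 2m≡Y (trans (ℕ.*-comm 2 w) (sym (_∣_.equality 2∣[m+1][n+1])))
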